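{- Let $z\ge0$ and $t$ be integers with $2\le t\le z+1$. Then the empty partition is the only $z$-asymmetric partition that is a $t$-core.
   Context: A partition $\lambda$ is $z$-asymmetric if in Frobenius coordinates $\lambda=(\alpha|\alpha+z)$: if $r$ is the rank of $\lambda$ (largest $r$ with $\lambda_r\ge r$), then $\alpha_i=\lambda_i-i$ and $\lambda'_i-i=\alpha_i+z$ for $1\le i\le r$ ($\lambda'$ the conjugate); the empty partition is $z$-asymmetric. A $t$-core is a partition with no cell of hook length divisible by $t$. -}

module Defs where

open import Data.Nat using (ℕ; zero; suc; _+_; _∸_; _≤_; _<_; _≥_; _≤?_; _⊔_)
open import Data.Nat.Divisibility using (_∣_)
open import Data.List using (List; []; _∷_; length; filter; upTo; map; foldr)
open import Data.List.Relation.Unary.All using (All)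
open import Data.List.Relation.Unary.Linked using (Linked)
open import Relation.Nullary using (¬_)
open import Relation.Binary.PropositionalEquality using (_≡_)

IsPartition : List ℕ → Set
IsPartition λs = All (λ p → 1 ≤ p) λs × Linked _≥_ λs
  where open import Data.Product using (_×_)

-- part λ i = λ_i (1-indexed); λ_i = 0 for i beyond the length (and λ_0 := 0 unused).
part : List ℕ → ℕ → ℕ
part []       _             = 0
part (x ∷ xs) zero          = 0
part (x ∷ xs) (suc zero)    = x
part (x ∷ xs) (suc (suc i)) = part xs (suc i)

conj : List ℕ → ℕ → ℕ
conj λs j = length (filter (λ p → j ≤? p) λs)

oneTo : ℕ → List ℕ
oneTo n = map suc (upTo n)

rank : List ℕ → ℕ
rank λs = foldr _⊔_ 0 (filter (λ i → i ≤? part λs i) (oneTo (length λs)))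

-- z-asymmetric: λ = (α | α + z), α_i = λ_i - i, λ'_i - i = α_i + z for 1 ≤ i ≤ r
ZAsymmetric : ℕ → List ℕ → Set
ZAsymmetric z λs = ∀ i → 1 ≤ i → i ≤ rank λs → conj λs i ∸ i ≡ (part λs i ∸ i) + z

hook : List ℕ → ℕ → ℕ → ℕ
hook λs i j = (part λs i ∸ j) + (conj λs j ∸ i) + 1

IsCore : ℕ → List ℕ → Set
IsCore t λs = ∀ i j → 1 ≤ i → 1 ≤ j → j ≤ part λs i → ¬ (t ∣ hook λs i j)

{-# OPTIONS --safe #-}
-- Let r ≥ 1 be the rank of a nonempty z-asymmetric partition λ. The leg of the
-- diagonal cell (r, r) is λ'_r − r = (λ_r − r) + z ≥ z, and every row strictly
-- below row r ends in column r or earlier. Walking up column r from its bottom,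
-- the cell (λ'_r − s, r) therefore ends its row and has hook length s + 1, for
-- each 1 ≤ s ≤ z; taking s = t − 1 contradicts λ being a t-core.
module Submission where

open import Defs
open import Data.Nat using (ℕ; zero; suc; _+_; _∸_; _≤_; _<_; _≥_; _≤?_; _⊔_; z≤n; s≤s)
open import Data.Nat.Properties
open import Data.Nat.Divisibility using (_∣_; ∣-refl)
open import Data.List using (List; []; _∷_; length; filter; foldr)
open import Data.List.Properties using (filter-accept; filter-reject; foldr-forcesᵇ)
open import Data.List.Relation.Unary.All as All using (All)
open import Data.List.Relation.Unary.Linked using (Linked; []; [-]; _∷_)
open import Data.List.Membership.Propositional using (_∈_)
open import Data.List.Membership.Propositional.Properties
  using (∈-map⁺; ∈-upTo⁺; ∈-filter⁺; ∈-filter⁻; foldr-selective)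
open import Data.Product using (_×_; _,_; proj₂; ∃-syntax)
open import Data.Sum using (inj₁; inj₂)
open import Data.Empty using (⊥-elim)
open import Relation.Nullary using (yes; no)
open import Relation.Binary.PropositionalEquality
  using (_≡_; refl; sym; trans; cong; subst; module ≡-Reasoning)

∈⇒≤foldr-⊔ : ∀ {x xs} → x ∈ xs → x ≤ foldr _⊔_ 0 xs
∈⇒≤foldr-⊔ {xs = xs} = All.lookup (foldr-forcesᵇ split 0 xs ≤-refl)
  where
  split : ∀ m n → m ⊔ n ≤ foldr _⊔_ 0 xs → m ≤ foldr _⊔_ 0 xs × n ≤ foldr _⊔_ 0 xs
  split m n le = m⊔n≤o⇒m≤o m n le , m⊔n≤o⇒n≤o m n le

∈oneTo : ∀ {n k} → 1 ≤ k → k ≤ n → k ∈ oneTo n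
∈oneTo {k = suc k} _ k<n = ∈-map⁺ suc (∈-upTo⁺ k<n)

part>0⇒≤length : ∀ L k → 1 ≤ part L k → k ≤ length L
part>0⇒≤length (x ∷ xs) zero          _ = z≤n
part>0⇒≤length (x ∷ xs) (suc zero)    _ = s≤s z≤n
part>0⇒≤length (x ∷ xs) (suc (suc k)) p = s≤s (part>0⇒≤length xs (suc k) p)

part-≤-head : ∀ {x xs} → Linked _≥_ (x ∷ xs) → ∀ k → part xs k ≤ x
part-≤-head {xs = []}     _          _             = z≤n
part-≤-head {xs = y ∷ ys} (y≤x ∷ _)  zero          = z≤n
part-≤-head {xs = y ∷ ys} (y≤x ∷ _)  (suc zero)    = y≤x
part-≤-head {xs = y ∷ ys} (y≤x ∷ ys↓) (suc (suc k)) = ≤-trans (part-≤-head ys↓ (suc k)) y≤x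

tail-linked : ∀ {x xs} → Linked _≥_ (x ∷ xs) → Linked _≥_ xs
tail-linked [-]      = []
tail-linked (_ ∷ l)  = l

part-antitone : ∀ {L} → Linked _≥_ L → ∀ {a b} → 1 ≤ a → a ≤ b → part L b ≤ part L a
part-antitone {[]}     _ _ _ = z≤n
part-antitone {x ∷ xs} _ {suc zero}    {suc zero}    _ _ = ≤-refl
part-antitone {x ∷ xs} l {suc zero}    {suc (suc b)} _ _ = part-≤-head l (suc b)
part-antitone {x ∷ xs} l {suc (suc a)} {suc (suc b)} _ (s≤s a≤b) =
  part-antitone (tail-linked l) (s≤s z≤n) a≤b

≤conj⇒≤part : ∀ {L} → Linked _≥_ L → ∀ {i j} → 1 ≤ i → i ≤ conj L j → j ≤ part L i
≤conj⇒≤part {[]}     _ (s≤s _) ()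
≤conj⇒≤part {x ∷ xs} l {i} {j} 1≤i i≤λ'j with j ≤? x
... | yes j≤x = top i 1≤i (subst (i ≤_) (cong length (filter-accept (j ≤?_) j≤x)) i≤λ'j)
  where
  top : ∀ i → 1 ≤ i → i ≤ suc (conj xs j) → j ≤ part (x ∷ xs) i
  top (suc zero)    _ _         = j≤x
  top (suc (suc i)) _ (s≤s i≤) = ≤conj⇒≤part (tail-linked l) (s≤s z≤n) i≤
... | no j≰x = ⊥-elim (j≰x (≤-trans (≤conj⇒≤part (tail-linked l) 1≤i i≤λ'j′) (part-≤-head l i)))
  where
  i≤λ'j′ : i ≤ conj xs j
  i≤λ'j′ = subst (i ≤_) (cong length (filter-reject (j ≤?_) j≰x)) i≤λ'j

≤part⇒≤rank : ∀ L {i} → 1 ≤ i → i ≤ part L i → i ≤ rank L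
≤part⇒≤rank L {i} 1≤i i≤λi = ∈⇒≤foldr-⊔ (∈-filter⁺ (λ k → k ≤? part L k)
  (∈oneTo 1≤i (part>0⇒≤length L i (≤-trans 1≤i i≤λi))) i≤λi)

rank≤part-rank : ∀ L → 1 ≤ rank L → rank L ≤ part L (rank L)
rank≤part-rank L 1≤r with foldr-selective ⊔-sel 0 (filter (λ k → k ≤? part L k) (oneTo (length L)))
... | inj₁ r≡0 = ⊥-elim (n>0⇒n≢0 1≤r r≡0)
... | inj₂ r∈ = proj₂ (∈-filter⁻ (λ k → k ≤? part L k) {xs = oneTo (length L)} r∈)

part-suc-rank≤rank : ∀ L → part L (suc (rank L)) ≤ rank L
part-suc-rank≤rank L with suc (rank L) ≤? part L (suc (rank L))
... | yes r<λ = ⊥-elim (n≮n _ (≤part⇒≤rank L (s≤s z≤n) r<λ))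
... | no  r≮λ = ≤-pred (≰⇒> r≮λ)

part-rankColumn : ∀ L → Linked _≥_ L → ∀ {i} → rank L < i → i ≤ conj L (rank L) →
                  part L i ≡ rank L
part-rankColumn L l r<i i≤λ'r = ≤-antisym
  (≤-trans (part-antitone l (s≤s z≤n) r<i) (part-suc-rank≤rank L))
  (≤conj⇒≤part l (≤-trans (s≤s z≤n) r<i) i≤λ'r)

hook-rowEnd : ∀ L {i j} → part L i ≡ j → hook L i j ≡ suc (conj L j ∸ i)
hook-rowEnd L {i} {j} λi≡j = begin
  (part L i ∸ j) + (conj L j ∸ i) + 1 ≡⟨ cong (λ a → a ∸ j + (conj L j ∸ i) + 1) λi≡j ⟩
  (j ∸ j) + (conj L j ∸ i) + 1        ≡⟨ cong (λ a → a + (conj L j ∸ i) + 1) (n∸n≡0 j) ⟩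
  (conj L j ∸ i) + 1                  ≡⟨ +-comm (conj L j ∸ i) 1 ⟩
  suc (conj L j ∸ i)                  ∎
  where open ≡-Reasoning

zAsymmetric⇒hook : ∀ {z s x xs} → IsPartition (x ∷ xs) → ZAsymmetric z (x ∷ xs) →
                   1 ≤ s → s ≤ z →
                   ∃[ i ] ∃[ j ] (1 ≤ i × 1 ≤ j × j ≤ part (x ∷ xs) i × hook (x ∷ xs) i j ≡ suc s)
zAsymmetric⇒hook {z} {s} {x} {xs} (positive , decreasing) zAsym 1≤s s≤z =
  i , r , ≤-trans 1≤r r≤i , 1≤r , ≤-reflexive (sym rowEnd) ,
  trans (hook-rowEnd L {i} rowEnd) (cong suc λ'r∸i≡s)
  where
  L = x ∷ xs
  r = rank L
  λ'r = conj L r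
  i = λ'r ∸ s

  1≤r : 1 ≤ r
  1≤r = ≤part⇒≤rank L (s≤s z≤n) (All.head positive)

  diagonalLeg : λ'r ∸ r ≡ (part L r ∸ r) + z
  diagonalLeg = zAsym r 1≤r ≤-refl

  s≤leg : s ≤ λ'r ∸ r
  s≤leg = ≤-trans s≤z (subst (z ≤_) (sym diagonalLeg) (m≤n+m z _))

  r≤λ'r : r ≤ λ'r
  r≤λ'r = <⇒≤ (m∸n≢0⇒n<m (n>0⇒n≢0 (≤-trans 1≤s s≤leg)))

  r≤i : r ≤ i
  r≤i = m+n≤o⇒m≤o∸n r (subst (_≤ λ'r) (+-comm s r) (m≤o∸n⇒m+n≤o s r≤λ'r s≤leg))

  λ'r∸i≡s : λ'r ∸ i ≡ s
  λ'r∸i≡s = m∸[m∸n]≡n (≤-trans s≤leg (m∸n≤m λ'r r))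

  -- If i = r the whole leg λ'r − r equals s ≤ z, so the arm λ_r − r vanishes.
  diagonalEnd : i ≡ r → part L r ≡ r
  diagonalEnd i≡r = ≤-antisym (m∸n≡0⇒m≤n armZero) (rank≤part-rank L 1≤r)
    where
    leg≡s : λ'r ∸ r ≡ s
    leg≡s = subst (λ k → λ'r ∸ k ≡ s) i≡r λ'r∸i≡s

    arm+z≤z : (part L r ∸ r) + z ≤ z
    arm+z≤z = subst (_≤ z) (trans (sym leg≡s) diagonalLeg) s≤z

    armZero : part L r ∸ r ≡ 0
    armZero = n≤0⇒n≡0 (subst (part L r ∸ r ≤_) (n∸n≡0 z) (m+n≤o⇒m≤o∸n _ arm+z≤z))

  rowEnd : part L i ≡ r
  rowEnd with m≤n⇒m<n∨m≡n r≤i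
  ... | inj₁ r<i = part-rankColumn L decreasing r<i (m∸n≤m λ'r s)
  ... | inj₂ r≡i = trans (cong (part L) (sym r≡i)) (diagonalEnd (sym r≡i))

lemma3p5 : (z t : ℕ) → 2 ≤ t → t ≤ z + 1 →
    (ZAsymmetric z [] × IsCore t [])
    × ((λs : List ℕ) → IsPartition λs → ZAsymmetric z λs → IsCore t λs → λs ≡ [])
lemma3p5 z (suc s) (s≤s 1≤s) t≤z+1 =
  ((λ { (suc i) _ () }) , (λ { i (suc j) _ _ () _ })) , onlyEmpty
  where
  s≤z : s ≤ z
  s≤z = ≤-pred (subst (suc s ≤_) (+-comm z 1) t≤z+1)

  onlyEmpty : (λs : List ℕ) → IsPartition λs → ZAsymmetric z λs → IsCore (suc s) λs → λs ≡ []
  onlyEmpty []       _ _     _    = refl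
  onlyEmpty (x ∷ xs) p zAsym core with zAsymmetric⇒hook p zAsym 1≤s s≤z
  ... | i , j , 1≤i , 1≤j , j≤λi , hook≡t =
    ⊥-elim (core i j 1≤i 1≤j j≤λi (subst (suc s ∣_) (sym hook≡t) ∣-refl))
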